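{- Consider any run of Algorithm ESS (defined in the context) with parameters $q\in(0,1]$ and $c>0$, and let $A=\bigcup_{i=1}^n S_i$. Then $f(A)\le\frac{c+1}{c}\,f(S_n)$.
   Context: Setting: a finite ground set $\mathcal N=\{u_1,\dots,u_n\}$ whose elements arrive in a stream in the order $u_1,\dots,u_n$. There are $m$ matroids $\mathcal M_\ell=(\mathcal N_\ell,\mathcal I_\ell)$ with $\mathcal N_\ell\subseteq\mathcal N$, and $\mathcal I=\{S\subseteq\mathcal N: S\cap\mathcal N_\ell\in\mathcal I_\ell\ \forall\ell\}$, where every element belongs to at most $p$ of the $\mathcal N_\ell$ (a $p$-matchoid). $f:2^{\mathcal N}\to\mathbb R_{\ge0}$ is non-negative submodular. Notation: $S+u=S\cup\{u\}$, $S-u=S\setminus\{u\}$, $f(u\mid S)=f(S\cup\{u\})-f(S)$; $f(u_i:S)=f(u_i\mid S\cap\{u_1,\dots,u_{i-1}\})$ and $f(B:S)=\sum_{u\in B}f(u:S)$. Procedure EC$(S,u)$: $U=\emptyset$; for $\ell=1,\dots,m$: if $(S+u)\cap\mathcal N_\ell\notin\mathcal I_\ell$, let $X_\ell=\{x\in S:(S-x+u)\cap\mathcal N_\ell\in\mathcal I_\ell\}$, let $x_\ell\in X_\ell$ minimize $f(x:S)$ (deterministic tie-breaking depending only on $S,u$), add $x_\ell$ to $U$. Return $U$. Algorithm ESS: $S_0=\emptyset$, $R=\emptyset$; for $i=1,\dots,n$: $S_i=S_{i-1}$; $U_i=\mathrm{EC}(S_{i-1},u_i)$; if $f(u_i\mid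 S_{i-1})\ge(1+c)f(U_i:S_{i-1})$ then with probability $q$ (independently) set $S_i=(S_{i-1}\setminus U_i)\cup\{u_i\}$, otherwise add $u_i$ to $R$. Return $S_n$.
   Formalization: The function $f$ takes values in the non-negative rationals rather than $\mathbb R_{\ge0}$, and the parameters $q$ and $c$ are rational. -}

module Defs where

open import Data.Nat as ℕ using (ℕ; suc; _<ᵇ_)
open import Data.Fin using (Fin; toℕ)
open import Data.Fin.Subset using (Subset; _∈_; _∉_; _⊆_; _∪_; _∩_; _-_; _─_; ⁅_⁆; ∣_∣; ⊥; ⋃)
open import Data.Vec using (tabulate; lookup)
open import Data.List using (List; foldr; map; allFin)
open import Data.Bool using (Bool; true; false; if_then_else_)
open import Data.Rational using (ℚ; 0ℚ; 1ℚ; _+_; _*_; _≤_)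
import Data.Rational
open import Data.Product using (Σ; ∃; ∃-syntax; _×_)
open import Data.Sum using (_⊎_)
open import Relation.Nullary using (¬_)
open import Relation.Binary.PropositionalEquality using (_≡_)

-- Ground set N = {u_1,...,u_n} is Fin n; element j : Fin n is u_{toℕ j + 1},
-- so the stream order is the order of Fin n.  Sets are Data.Fin.Subset.

SetFun : ℕ → Set
SetFun n = Subset n → ℚ

NonNegative : ∀ {n} → SetFun n → Set
NonNegative f = ∀ A → 0ℚ ≤ f A

Submodular : ∀ {n} → SetFun n → Set
Submodular f = ∀ A B → f (A ∪ B) + f (A ∩ B) ≤ f A + f B

marg : ∀ {n} → SetFun n → Fin n → Subset n → ℚ
marg f u S = f (S ∪ ⁅ u ⁆) Data.Rational.- f S

before : ∀ {n} → Fin n → Subset n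
before u = tabulate (λ j → toℕ j <ᵇ toℕ u)

colon : ∀ {n} → SetFun n → Fin n → Subset n → ℚ
colon f u S = marg f u (S ∩ before u)

colonSet : ∀ {n} → SetFun n → Subset n → Subset n → ℚ
colonSet {n} f B S =
  foldr _+_ 0ℚ (map (λ u → if lookup B u then colon f u S else 0ℚ) (allFin n))

-- Matroids.  A matroid (N_ℓ, I_ℓ) with N_ℓ ⊆ N is given by its ground set
-- Nℓ : Subset n and an independence predicate on subsets of N.

record IsMatroid {n : ℕ} (Nℓ : Subset n) (Ind : Subset n → Set) : Set where
  field
    ground     : ∀ {A} → Ind A → A ⊆ Nℓ
    emptyInd   : Ind ⊥
    hereditary : ∀ {A B} → B ⊆ A → Ind A → Ind B
    exchange   : ∀ {A B} → Ind A → Ind B → ∣ A ∣ ℕ.< ∣ B ∣ →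
                 ∃[ x ] (x ∈ B × x ∉ A × Ind (A ∪ ⁅ x ⁆))

-- p-matchoid: m matroids on subsets of N, each element in at most p grounds.
record Matchoid (n m p : ℕ) : Set₁ where
  field
    Gr      : Fin m → Subset n
    Ind     : Fin m → Subset n → Set
    matroid : ∀ ℓ → IsMatroid (Gr ℓ) (Ind ℓ)
    pBound  : ∀ (u : Fin n) → ∣ tabulate (λ ℓ → lookup (Gr ℓ) u) ∣ ℕ.≤ p

module _ {n m p : ℕ} (M : Matchoid n m p) (f : SetFun n) where
  open Matchoid M

  Violated : Subset n → Fin n → Fin m → Set
  Violated S u ℓ = ¬ Ind ℓ ((S ∪ ⁅ u ⁆) ∩ Gr ℓ)

  InX : Subset n → Fin n → Fin m → Fin n → Set
  InX S u ℓ x = x ∈ S × Ind ℓ (((S - x) ∪ ⁅ u ⁆) ∩ Gr ℓ)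

  -- U is a possible output of EC(S,u): for every violated ℓ a choice
  -- x_ℓ ∈ X_ℓ minimising f(x : S), and U = { x_ℓ }.
  IsEC : Subset n → Fin n → Subset n → Set
  IsEC S u U =
    Σ ((ℓ : Fin m) → Violated S u ℓ → Fin n) λ ch →
      (∀ ℓ v → InX S u ℓ (ch ℓ v) ×
               (∀ y → InX S u ℓ y → colon f (ch ℓ v) S ≤ colon f y S)) ×
      (∀ x → x ∈ U → ∃[ ℓ ] Σ (Violated S u ℓ) λ v → ch ℓ v ≡ x) ×
      (∀ ℓ v → ch ℓ v ∈ U)

  -- One iteration i of ESS (element u = u_i), with coin outcome b
  -- (b = true: the probability-q event happened).
  Step : ℚ → Fin n → Bool → Subset n → Subset n → Set
  Step c u b S S' =
    ∃[ U ] (IsEC S u U ×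
      (( (1ℚ + c) * colonSet f U S ≤ marg f u S × b ≡ true ×
         S' ≡ (S ─ U) ∪ ⁅ u ⁆)
       ⊎
       ((¬ ((1ℚ + c) * colonSet f U S ≤ marg f u S) ⊎ b ≡ false) ×
         S' ≡ S)))

  -- A run of ESS with parameter c and coin outcomes `coin`:
  -- the sequence S_0, S_1, ..., S_n (S i for i ≤ n).
  IsRun : ℚ → (Fin n → Bool) → (ℕ → Subset n) → Set
  IsRun c coin S =
    S 0 ≡ ⊥ × (∀ (i : Fin n) → Step c i (coin i) (S (toℕ i)) (S (suc (toℕ i))))

unionRun : ∀ {n} → (ℕ → Subset n) → Subset n
unionRun {n} S = ⋃ (map (λ (i : Fin n) → S (suc (toℕ i))) (allFin n))

{-# OPTIONS --safe #-}
-- Write A_j = S_1 ∪ ⋯ ∪ S_j. The invariant c·f(A_j) ≤ (c+1)·f(S_j) holds for j = 0 because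
-- f(∅) ≥ 0, and no step breaks it. A rejected element changes nothing. If u = u_{j+1} replaces
-- U ⊆ S_j, put T = S_j ∖ U, so that S_{j+1} = T + u and A_{j+1} = A_j + u. As T ⊆ S_j ⊆ A_j and u
-- comes after every element seen so far, submodularity gives f(u | A_j) ≤ f(u | T) and
-- f(u | S_j) ≤ f(u | T), and telescoping along the stream gives f(S_j) − f(T) ≤ f(U : S_j).
-- With the acceptance test (1+c)·f(U : S_j) ≤ f(u | S_j) these add up to the invariant at j+1.
module Submission where

open import Defs
open import Data.Fin.Subset using (Subset)
open import Data.Nat using (ℕ)
open import Data.Fin using (Fin)
open import Data.Bool using (Bool; true)
open import Data.Rational using (ℚ; 0ℚ; 1ℚ; _+_; _*_; _≤_; _<_; _÷_; positive)
open import Data.Rational.Properties using (pos⇒nonZero)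
open import Relation.Binary.PropositionalEquality using (_≡_)

import Data.Nat as ℕ
import Data.Nat.Properties as ℕ
open import Data.Fin using (zero; suc; toℕ; fromℕ<)
open import Data.Fin.Properties using (toℕ-fromℕ<)
open import Data.Fin.Subset using (_∈_; _∉_; _⊆_; _∪_; _∩_; _─_; ⁅_⁆; ⊥; ⋃)
open import Data.Fin.Subset.Properties
  using (⊆-antisym; ⊆-min; ⊆-trans; p⊆p∪q; q⊆p∪q; x∈p∪q⁻; x∈p∩q⁻; x∈p∩q⁺; x∈⁅y⁆⇒x≡y;
         p─q⊆p; drop-∷-⊆; ∉⊥; ∪-assoc; ∪-identityˡ; ∪-identityʳ; ∩-zeroʳ)
open import Data.Bool using (false; if_then_else_)
open import Data.Vec using (_∷_; []; lookup; here)
open import Data.Vec.Properties using (tabulate-cong; tabulate∘lookup; lookup-replicate)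
import Data.List as List
import Data.List.Properties as List
open import Data.Rational using (-_; _-_; 1/_; Positive; NonZero; nonNegative)
  renaming (NonNegative to NonNegativeℚ)
import Data.Rational.Properties as ℚ
open import Data.Rational.Solver using (module +-*-Solver)
open +-*-Solver
open import Data.Product using (_,_; proj₁; proj₂)
open import Data.Sum using (inj₁; inj₂; [_,_]′)
open import Function using (_∘_; id)
open import Relation.Nullary using (contradiction)
open import Relation.Binary.PropositionalEquality
  using (refl; sym; trans; cong; subst; subst₂; module ≡-Reasoning)

a+b≤c+d⇒a-d≤c-b : ∀ a b c d → a + b ≤ c + d → a - d ≤ c - b
a+b≤c+d⇒a-d≤c-b a b c d a+b≤c+d =
  subst₂ _≤_ (cancelˡ a b d) (cancelʳ c d b) (ℚ.+-monoˡ-≤ (- b - d) a+b≤c+d)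
  where
  cancelˡ : ∀ x y z → (x + y) + (- y - z) ≡ x - z
  cancelˡ = solve 3 (λ x y z → (x :+ y) :+ (:- y :- z) := x :- z) refl
  cancelʳ : ∀ x y z → (x + y) + (- z - y) ≡ x - z
  cancelʳ = solve 3 (λ x y z → (x :+ y) :+ (:- z :- y) := x :- z) refl

p*r≤[p+1]*r : ∀ p {r} → 0ℚ ≤ r → p * r ≤ (p + 1ℚ) * r
p*r≤[p+1]*r p {r} 0≤r = begin
  p * r         ≡⟨ ℚ.+-identityʳ (p * r) ⟨
  p * r + 0ℚ    ≤⟨ ℚ.+-monoʳ-≤ (p * r) 0≤r ⟩
  p * r + r     ≡⟨ solve 2 (λ p r → p :* r :+ r := (p :+ con 1ℚ) :* r) refl p r ⟩
  (p + 1ℚ) * r  ∎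
  where open ℚ.≤-Reasoning

c*p≤d*q⇒p≤d÷c*q : ∀ {p} c d q .{{_ : Positive c}} →
  c * p ≤ d * q → p ≤ (d ÷ c) {{pos⇒nonZero c}} * q
c*p≤d*q⇒p≤d÷c*q {p} c d q c*p≤d*q =
  ℚ.*-cancelˡ-≤-pos c (subst (c * p ≤_) (sym c*[d÷c*q]≡d*q) c*p≤d*q)
  where
  instance
    c-nonZero : NonZero c
    c-nonZero = pos⇒nonZero c
  open ≡-Reasoning
  c*[d÷c*q]≡d*q : c * ((d ÷ c) * q) ≡ d * q
  c*[d÷c*q]≡d*q = begin
    c * ((d * 1/ c) * q)  ≡⟨ solve 4 (λ c w d q → c :* ((d :* w) :* q) := (c :* w) :* (d :* q))
                                     refl c (1/ c) d q ⟩
    (c * 1/ c) * (d * q)  ≡⟨ cong (_* (d * q)) (ℚ.*-inverseʳ c) ⟩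
    1ℚ * (d * q)          ≡⟨ ℚ.*-identityˡ (d * q) ⟩
    d * q                 ∎

-- The hypotheses after 0 ≤ c are the invariant before the step, f(u | A) ≤ f(u | T), the
-- telescoping bound f(S) − f(T) ≤ f(U : S), and the acceptance test weakened by
-- f(u | S) ≤ f(u | T); here a = f(A), a′ = f(A + u), s = f(S), t = f(T), t′ = f(T + u), F = f(U : S).
accepted-step-≤ : ∀ {c a a′ s t t′ F} → 0ℚ ≤ c →
  c * a ≤ (c + 1ℚ) * s → a′ - a ≤ t′ - t → s - t ≤ F → (1ℚ + c) * F ≤ t′ - t →
  c * a′ ≤ (c + 1ℚ) * t′
accepted-step-≤ {c} {a} {a′} {s} {t} {t′} {F} 0≤c inv gain loss accept = begin
  c * a′
    ≡⟨ solve 3 (λ c a a′ → c :* a′ := c :* a :+ c :* (a′ :- a)) refl c a a′ ⟩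
  c * a + c * (a′ - a)
    ≤⟨ ℚ.+-mono-≤ inv (ℚ.*-monoˡ-≤-nonNeg c gain) ⟩
  (c + 1ℚ) * s + c * (t′ - t)
    ≡⟨ solve 4 (λ c s t t′ → (c :+ con 1ℚ) :* s :+ c :* (t′ :- t)
                 := ((c :+ con 1ℚ) :* t :+ c :* (t′ :- t)) :+ (con 1ℚ :+ c) :* (s :- t))
               refl c s t t′ ⟩
  ((c + 1ℚ) * t + c * (t′ - t)) + (1ℚ + c) * (s - t)
    ≤⟨ ℚ.+-monoʳ-≤ ((c + 1ℚ) * t + c * (t′ - t))
                   (ℚ.≤-trans (ℚ.*-monoˡ-≤-nonNeg (1ℚ + c) loss) accept) ⟩
  ((c + 1ℚ) * t + c * (t′ - t)) + (t′ - t)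
    ≡⟨ solve 3 (λ c t t′ → ((c :+ con 1ℚ) :* t :+ c :* (t′ :- t)) :+ (t′ :- t)
                 := (c :+ con 1ℚ) :* t′)
               refl c t t′ ⟩
  (c + 1ℚ) * t′ ∎
  where
  open ℚ.≤-Reasoning
  instance
    c-nonNeg : NonNegativeℚ c
    c-nonNeg = nonNegative 0≤c
    1+c-nonNeg : NonNegativeℚ (1ℚ + c)
    1+c-nonNeg = ℚ.nonNeg+nonNeg⇒nonNeg 1ℚ c

q⊆p⇒p∪q≡p : ∀ {n} {p q : Subset n} → q ⊆ p → p ∪ q ≡ p
q⊆p⇒p∪q≡p {p = p} {q} q⊆p = ⊆-antisym (λ x∈p∪q → [ id , q⊆p ]′ (x∈p∪q⁻ p q x∈p∪q)) (p⊆p∪q q)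

marg-antitone : ∀ {n} (f : SetFun n) {X Y : Subset n} {u : Fin n} →
  Submodular f → X ⊆ Y → u ∉ Y → marg f u Y ≤ marg f u X
marg-antitone f {X} {Y} {u} sub X⊆Y u∉Y =
  a+b≤c+d⇒a-d≤c-b (f (Y ∪ ⁅ u ⁆)) (f X) (f (X ∪ ⁅ u ⁆)) (f Y)
    (subst₂ (λ A B → f A + f B ≤ f (X ∪ ⁅ u ⁆) + f Y) union-eq inter-eq (sub (X ∪ ⁅ u ⁆) Y))
  where
  union-eq : (X ∪ ⁅ u ⁆) ∪ Y ≡ Y ∪ ⁅ u ⁆
  union-eq = ⊆-antisym
    (λ x∈ → [ (λ x∈X∪u → [ p⊆p∪q _ ∘ X⊆Y , q⊆p∪q Y _ ]′ (x∈p∪q⁻ X _ x∈X∪u)) , p⊆p∪q _ ]′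
              (x∈p∪q⁻ _ Y x∈))
    (λ x∈ → [ q⊆p∪q _ Y , p⊆p∪q Y ∘ q⊆p∪q X _ ]′ (x∈p∪q⁻ Y _ x∈))
  inter-eq : (X ∪ ⁅ u ⁆) ∩ Y ≡ X
  inter-eq = ⊆-antisym
    (λ x∈ → let x∈X∪u , x∈Y = x∈p∩q⁻ _ Y x∈ in
      [ id , (λ x∈u → contradiction (subst (_∈ Y) (x∈⁅y⁆⇒x≡y u x∈u) x∈Y) u∉Y) ]′
        (x∈p∪q⁻ X _ x∈X∪u))
    (λ x∈X → x∈p∩q⁺ (p⊆p∪q _ x∈X , X⊆Y x∈X))

before-zero : ∀ {n} → before {ℕ.suc n} zero ≡ ⊥
before-zero = trans (tabulate-cong (λ i → sym (lookup-replicate i false))) (tabulate∘lookup ⊥)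

colon-zero : ∀ {n} (f : SetFun (ℕ.suc n)) S → colon f zero S ≡ marg f zero ⊥
colon-zero f S = cong (marg f zero) (trans (cong (S ∩_) before-zero) (∩-zeroʳ S))

-- Holds by computation once s is a constructor, since before (suc j) reduces to true ∷ before j.
colon-suc : ∀ {n} (f : SetFun (ℕ.suc n)) s S (j : Fin n) →
  colon f (suc j) (s ∷ S) ≡ colon (f ∘ (s ∷_)) j S
colon-suc f true  S j = refl
colon-suc f false S j = refl

colonSet-∷ : ∀ {n} (f : SetFun (ℕ.suc n)) b s (U S : Subset n) →
  colonSet f (b ∷ U) (s ∷ S) ≡
    (if b then colon f zero (s ∷ S) else 0ℚ) + colonSet (f ∘ (s ∷_)) U S
colonSet-∷ {n} f b s U S = cong (term f (b ∷ U) (s ∷ S) zero +_) (cong (List.foldr _+_ 0ℚ) (begin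
  List.map (term f (b ∷ U) (s ∷ S)) (List.tabulate suc)  ≡⟨ List.map-tabulate suc _ ⟩
  List.tabulate (term f (b ∷ U) (s ∷ S) ∘ suc)
    ≡⟨ List.tabulate-cong (λ j → cong (if lookup U j then_else 0ℚ) (colon-suc f s S j)) ⟩
  List.tabulate (term (f ∘ (s ∷_)) U S)                  ≡⟨ List.map-tabulate id _ ⟨
  List.map (term (f ∘ (s ∷_)) U S) (List.allFin n)       ∎))
  where
  open ≡-Reasoning
  term : ∀ {k} → SetFun k → Subset k → Subset k → Fin k → ℚ
  term f U S u = if lookup U u then colon f u S else 0ℚ

submodular-∷ : ∀ {n} (f : SetFun (ℕ.suc n)) s → Submodular f → Submodular (f ∘ (s ∷_))
submodular-∷ f true  sub A B = sub (true ∷ A) (true ∷ B)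
submodular-∷ f false sub A B = sub (false ∷ A) (false ∷ B)

loss≤colonSet : ∀ {n} (f : SetFun n) {U S : Subset n} →
  Submodular f → U ⊆ S → f S - f (S ─ U) ≤ colonSet f U S
loss≤colonSet f {[]} {[]} sub _ = ℚ.≤-reflexive (ℚ.+-inverseʳ (f []))
loss≤colonSet f {false ∷ U} {s ∷ S} sub U⊆S =
  subst (f (s ∷ S) - f (s ∷ (S ─ U)) ≤_)
    (trans (sym (ℚ.+-identityˡ _)) (sym (colonSet-∷ f false s U S)))
    (loss≤colonSet (f ∘ (s ∷_)) (submodular-∷ f s sub) (drop-∷-⊆ U⊆S))
loss≤colonSet f {true ∷ U} {false ∷ S} sub U⊆S with () ← U⊆S here
loss≤colonSet f {true ∷ U} {true ∷ S} sub U⊆S = begin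
  f (true ∷ S) - f (false ∷ T)
    ≡⟨ solve 3 (λ a b c → a :- c := (a :- b) :+ (b :- c)) refl
               (f (true ∷ S)) (f (true ∷ T)) (f (false ∷ T)) ⟩
  (f (true ∷ S) - f (true ∷ T)) + (f (true ∷ T) - f (false ∷ T))
    ≤⟨ ℚ.+-mono-≤ (loss≤colonSet (f ∘ (true ∷_)) (submodular-∷ f true sub) (drop-∷-⊆ U⊆S))
                  first-loss ⟩
  colonSet (f ∘ (true ∷_)) U S + colon f zero (true ∷ S)
    ≡⟨ ℚ.+-comm (colonSet (f ∘ (true ∷_)) U S) _ ⟩
  colon f zero (true ∷ S) + colonSet (f ∘ (true ∷_)) U S
    ≡⟨ colonSet-∷ f true true U S ⟨
  colonSet f (true ∷ U) (true ∷ S) ∎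
  where
  open ℚ.≤-Reasoning
  T : Subset _
  T = S ─ U
  first-loss : f (true ∷ T) - f (false ∷ T) ≤ colon f zero (true ∷ S)
  first-loss = begin
    f (true ∷ T) - f (false ∷ T)  ≡⟨ cong (λ X → f (true ∷ X) - f (false ∷ T)) (∪-identityʳ T) ⟨
    marg f zero (false ∷ T)       ≤⟨ marg-antitone f {u = zero} sub (⊆-min (false ∷ T)) (λ ()) ⟩
    marg f zero ⊥                 ≡⟨ colon-zero f (true ∷ S) ⟨
    colon f zero (true ∷ S)       ∎

module _ {n m p : ℕ} (M : Matchoid n m p) (f : SetFun n) where

  IsEC⇒⊆ : ∀ {S u U} → IsEC M f S u U → U ⊆ S
  IsEC⇒⊆ (_ , choice-spec , chosen , _) {x} x∈U with chosen x x∈U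
  ... | ℓ , v , refl = proj₁ (proj₁ (choice-spec ℓ v))

  Step⇒⊆ : ∀ {c u b S S′} → Step M f c u b S S′ → S′ ⊆ S ∪ ⁅ u ⁆
  Step⇒⊆ {S = S} (U , _ , inj₁ (_ , _ , refl)) x∈S′ =
    [ p⊆p∪q _ ∘ p─q⊆p S U , q⊆p∪q S _ ]′ (x∈p∪q⁻ (S ─ U) _ x∈S′)
  Step⇒⊆ (_ , _ , inj₂ (_ , refl)) = p⊆p∪q _

  Step-preserves-union-bound : ∀ {c u b S S′ A} → Submodular f → 0ℚ ≤ c →
    Step M f c u b S S′ → S ⊆ A → u ∉ A →
    c * f A ≤ (c + 1ℚ) * f S → c * f (A ∪ S′) ≤ (c + 1ℚ) * f S′
  Step-preserves-union-bound {c} _ _ (_ , _ , inj₂ (_ , refl)) S⊆A _ inv =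
    subst (λ B → c * f B ≤ _) (sym (q⊆p⇒p∪q≡p S⊆A)) inv
  Step-preserves-union-bound {c} {u} {S = S} {A = A} sub 0≤c
                             (U , ec , inj₁ (accept , _ , refl)) S⊆A u∉A inv =
    subst (λ B → c * f B ≤ _) (sym A∪S′≡A∪u)
      (accepted-step-≤ 0≤c inv gain (loss≤colonSet f sub (IsEC⇒⊆ ec)) accept′)
    where
    T : Subset n
    T = S ─ U
    T⊆S : T ⊆ S
    T⊆S = p─q⊆p S U
    A∪S′≡A∪u : A ∪ (T ∪ ⁅ u ⁆) ≡ A ∪ ⁅ u ⁆
    A∪S′≡A∪u = trans (sym (∪-assoc A T _)) (cong (_∪ ⁅ u ⁆) (q⊆p⇒p∪q≡p (⊆-trans T⊆S S⊆A)))
    gain : marg f u A ≤ marg f u T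
    gain = marg-antitone f sub (⊆-trans T⊆S S⊆A) u∉A
    accept′ : (1ℚ + c) * colonSet f U S ≤ marg f u T
    accept′ = ℚ.≤-trans accept (marg-antitone f sub T⊆S (u∉A ∘ S⊆A))

runUnion : ∀ {k} → (ℕ → Subset k) → ℕ → Subset k
runUnion S ℕ.zero    = ⊥
runUnion S (ℕ.suc j) = runUnion S j ∪ S (ℕ.suc j)

runUnion-shift : ∀ {k} (S : ℕ → Subset k) j →
  runUnion S (ℕ.suc j) ≡ S 1 ∪ runUnion (S ∘ ℕ.suc) j
runUnion-shift S ℕ.zero    = trans (∪-identityˡ (S 1)) (sym (∪-identityʳ (S 1)))
runUnion-shift S (ℕ.suc j) =
  trans (cong (_∪ S (2 ℕ.+ j)) (runUnion-shift S j)) (∪-assoc (S 1) _ _)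

⋃-tabulate≡runUnion : ∀ {k} (S : ℕ → Subset k) n →
  ⋃ (List.tabulate {n = n} (λ i → S (ℕ.suc (toℕ i)))) ≡ runUnion S n
⋃-tabulate≡runUnion S ℕ.zero    = refl
⋃-tabulate≡runUnion S (ℕ.suc n) =
  trans (cong (S 1 ∪_) (⋃-tabulate≡runUnion (S ∘ ℕ.suc) n)) (sym (runUnion-shift S n))

unionRun≡runUnion : ∀ {n} (S : ℕ → Subset n) → unionRun S ≡ runUnion S n
unionRun≡runUnion {n} S =
  trans (cong ⋃ (List.map-tabulate {n = n} id (λ i → S (ℕ.suc (toℕ i)))))
        (⋃-tabulate≡runUnion S n)

Below : ∀ {n} → ℕ → Subset n → Set
Below k X = ∀ {x} → x ∈ X → toℕ x ℕ.< k

module Run {n m p : ℕ} (M : Matchoid n m p) (f : SetFun n) (c : ℚ) (coin : Fin n → Bool)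
           (S : ℕ → Subset n) (run : IsRun M f c coin S) where

  step : ∀ {j} (j<n : j ℕ.< n) →
    Step M f c (fromℕ< j<n) (coin (fromℕ< j<n)) (S j) (S (ℕ.suc j))
  step j<n = subst (λ k → Step M f c u (coin u) (S k) (S (ℕ.suc k)))
                   (toℕ-fromℕ< j<n) (proj₂ run u)
    where u = fromℕ< j<n

  S-below : ∀ j → j ℕ.≤ n → Below j (S j)
  S-below ℕ.zero    _   x∈S₀ = contradiction (subst (_ ∈_) (proj₁ run) x∈S₀) ∉⊥
  S-below (ℕ.suc j) j<n x∈ =
    [ ℕ.m<n⇒m<1+n ∘ S-below j (ℕ.<⇒≤ j<n) , (λ x∈u → ℕ.≤-reflexive (cong ℕ.suc (toℕ≡j x∈u))) ]′
      (x∈p∪q⁻ _ _ (Step⇒⊆ M f {c} (step j<n) x∈))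
    where
    toℕ≡j : ∀ {x} → x ∈ ⁅ fromℕ< j<n ⁆ → toℕ x ≡ j
    toℕ≡j x∈u = trans (cong toℕ (x∈⁅y⁆⇒x≡y _ x∈u)) (toℕ-fromℕ< j<n)

  runUnion-below : ∀ j → j ℕ.≤ n → Below j (runUnion S j)
  runUnion-below ℕ.zero    _   x∈⊥ = contradiction x∈⊥ ∉⊥
  runUnion-below (ℕ.suc j) j<n x∈ =
    [ ℕ.m<n⇒m<1+n ∘ runUnion-below j (ℕ.<⇒≤ j<n) , S-below (ℕ.suc j) j<n ]′ (x∈p∪q⁻ _ _ x∈)

  S⊆runUnion : ∀ j → S j ⊆ runUnion S j
  S⊆runUnion ℕ.zero    = subst (_ ∈_) (proj₁ run)
  S⊆runUnion (ℕ.suc j) = q⊆p∪q (runUnion S j) _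

  union-bound : Submodular f → NonNegative f → 0ℚ ≤ c →
    ∀ j → j ℕ.≤ n → c * f (runUnion S j) ≤ (c + 1ℚ) * f (S j)
  union-bound sub nonneg 0≤c ℕ.zero _ rewrite proj₁ run = p*r≤[p+1]*r c (nonneg ⊥)
  union-bound sub nonneg 0≤c (ℕ.suc j) j<n =
    Step-preserves-union-bound M f {c} sub 0≤c (step j<n) (S⊆runUnion j) u∉
      (union-bound sub nonneg 0≤c j (ℕ.<⇒≤ j<n))
    where
    u∉ : fromℕ< j<n ∉ runUnion S j
    u∉ u∈ = ℕ.<-irrefl (toℕ-fromℕ< j<n) (runUnion-below j (ℕ.<⇒≤ j<n) u∈)

-- The bound holds for every outcome of the coins.
mainTheorem4 : ∀ {n m p : ℕ} (M : Matchoid n m p) (f : SetFun n) →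
    NonNegative f → Submodular f →
    (q c : ℚ) → 0ℚ < q → q ≤ 1ℚ → (c>0 : 0ℚ < c) →
    (coin : Fin n → Bool) → (q ≡ 1ℚ → ∀ i → coin i ≡ true) →
    (S : ℕ → Subset n) → IsRun M f c coin S →
    f (unionRun S) ≤ (_÷_ (c + 1ℚ) c {{pos⇒nonZero c {{positive c>0}}}}) * f (S n)
mainTheorem4 {n} M f nonneg sub _ c _ _ c>0 coin _ S run = begin
  f (unionRun S)            ≡⟨ cong f (unionRun≡runUnion S) ⟩
  f (runUnion S n)          ≤⟨ c*p≤d*q⇒p≤d÷c*q c (c + 1ℚ) (f (S n))
                                 (union-bound sub nonneg (ℚ.<⇒≤ c>0) n ℕ.≤-refl) ⟩
  ((c + 1ℚ) ÷ c) * f (S n)  ∎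
  where
  open ℚ.≤-Reasoning
  open Run M f c coin S run
  instance
    c-positive : Positive c
    c-positive = positive c>0
    c-nonZero : NonZero c
    c-nonZero = pos⇒nonZero c
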